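{- Let $d$ and $n$ be positive integers and let $m=(d-1)n+1$. The number of $d$-ary trees with $n$ nodes and $m$ leaves whose nodes carry $n$ distinct labels and whose leaves carry $m$ distinct labels is $(dn)!$. Equivalently, the number of such trees labeled by node labels $0,\dots,n-1$ and leaf labels $n,\dots,dn$ (each label used exactly once) equals the number of permutations of $\{0,\dots,dn-1\}$.
   Context: A $d$-ary tree is a rooted tree in which every (nonterminal) node has exactly $d$ children, arranged in order (a $0$th, $1$st, ..., $(d-1)$th child), and leaves have no children. The term "node" refers only to nonterminal nodes. A $d$-ary tree with $n$ nodes has $(d-1)n+1$ leaves. Two labeled trees are equal if they have the same shape and the same labels in the same positions. -}

module Defs where

open import Data.Nat using (ℕ; _+_; _*_; _∸_)
open import Data.List using (List; []; _∷_; _++_; map; upTo)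
open import Data.Vec using (Vec; []; _∷_)
open import Data.Product using (_×_)
open import Data.List.Relation.Binary.Permutation.Propositional using (_↭_)

data Tree (d : ℕ) : Set where
  leaf : ℕ → Tree d
  node : ℕ → Vec (Tree d) d → Tree d

mutual
  nodeLabels : ∀ {d} → Tree d → List ℕ
  nodeLabels (leaf _)    = []
  nodeLabels (node x ts) = x ∷ nodeLabelsV ts

  nodeLabelsV : ∀ {d k} → Vec (Tree d) k → List ℕ
  nodeLabelsV []       = []
  nodeLabelsV (t ∷ ts) = nodeLabels t ++ nodeLabelsV ts

mutual
  leafLabels : ∀ {d} → Tree d → List ℕ
  leafLabels (leaf x)    = x ∷ []
  leafLabels (node _ ts) = leafLabelsV ts

  leafLabelsV : ∀ {d k} → Vec (Tree d) k → List ℕ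
  leafLabelsV []       = []
  leafLabelsV (t ∷ ts) = leafLabels t ++ leafLabelsV ts

-- t is a d-ary tree whose node labels are exactly 0,…,n-1 (each once)
-- and whose leaf labels are exactly n,…,n+m-1 = n,…,dn (each once),
-- where m = (d-1)n+1.  (This forces t to have n nodes and m leaves.)
Labeled : (d n : ℕ) → Tree d → Set
Labeled d n t =
  (nodeLabels t ↭ upTo n) ×
  (leafLabels t ↭ map (n +_) (upTo ((d ∸ 1) * n + 1)))

{-# OPTIONS --safe #-}
module Submission where

-- Listing trees in preorder, it suffices to count ordered forests. A forest of
-- k trees with s node labels and t leaf labels starts either with a leaf (t
-- choices of label, k - 1 trees remain) or with a node (s choices, its d children
-- join the remaining trees, giving d + k - 1 trees). Enumerating along this
-- choice yields a duplicate-free complete list, whose length F(k,s,t) satisfies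
-- F(k,s,t) = t F(k-1,s,t-1) + s F(d+k-1,s-1,t). Whenever t = (d-1)s + k, this is
-- solved by F = k (ds+k-1)!, and a single tree with n nodes gives (dn)!.

open import Data.Nat using (ℕ; zero; suc; pred; _+_; _*_; _≤_; _!)
open import Data.Nat.Properties
  using (+-identityʳ; *-identityˡ; *-zeroʳ; +-cancelˡ-≡; +-suc; suc-injective)
open import Data.Nat.Tactic.RingSolver using (solve-∀)
open import Data.Empty using (⊥)
open import Data.Sum using (_⊎_; inj₁; inj₂)
open import Data.Sum.Properties using (inj₁-injective; inj₂-injective)
open import Data.Product using (∃; ∃₂; _×_; _,_; proj₁; map₂; uncurry)
open import Data.List using (List; []; _∷_; [_]; _++_; map; concatMap; length; upTo)
open import Data.List.Properties
  using (length-++; length-map; length-upTo; map-∘; ++-assoc; ++-identityʳ)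
open import Data.List.Relation.Unary.Any using (here; there)
open import Data.List.Relation.Unary.All using (All; [])
import Data.List.Relation.Unary.All as All
import Data.List.Relation.Unary.All.Properties as All
open import Data.List.Relation.Unary.Unique.Propositional using (Unique; []; _∷_)
import Data.List.Relation.Unary.Unique.Propositional.Properties as Unique
open import Data.List.Membership.Propositional using (_∈_; find; lose)
open import Data.List.Membership.Propositional.Properties
  using (∈-map⁺; ∈-map⁻; ∈-++⁺ˡ; ∈-++⁺ʳ; ∈-++⁻; ∈-concatMap⁺; ∈-concatMap⁻)
open import Data.List.Relation.Binary.Permutation.Propositional
  using (_↭_; ↭-refl; ↭-prep; ↭-swap; ↭-trans; ↭-sym; ↭⇒↭ₛ)
open import Data.List.Relation.Binary.Permutation.Propositional.Properties
  using (↭-length; drop-∷; ∈-resp-↭)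
import Data.List.Relation.Binary.Permutation.Setoid.Properties as Permutationₛ
open import Data.Vec using (Vec; []; _∷_; take; drop; head) renaming (_++_ to _++ᵥ_)
open import Data.Vec.Properties
  using (take++drop≡id; ++-injectiveˡ; ++-injectiveʳ; ∷-injectiveˡ; ∷-injectiveʳ)
open import Relation.Binary.PropositionalEquality
  using (_≡_; refl; sym; trans; cong; cong₂; subst; setoid; module ≡-Reasoning)
open import Defs

module _ {a} {A : Set a} where

  select : List A → List (A × List A)
  select []       = []
  select (x ∷ xs) = (x , xs) ∷ map (map₂ (x ∷_)) (select xs)

  select-↭ : ∀ {xs x r} → (x , r) ∈ select xs → xs ↭ x ∷ r
  select-↭ {_ ∷ _}  (here refl) = ↭-refl
  select-↭ {y ∷ xs} (there p) with ∈-map⁻ (map₂ (y ∷_)) p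
  ... | (x , r) , q , refl = ↭-trans (↭-prep y (select-↭ q)) (↭-swap y x ↭-refl)

  ∈-select : ∀ {xs x} → x ∈ xs → ∃ λ r → (x , r) ∈ select xs
  ∈-select {x ∷ xs} (here refl) = xs , here refl
  ∈-select {y ∷ xs} (there p) =
    let r , q = ∈-select p in y ∷ r , there (∈-map⁺ (map₂ (y ∷_)) q)

  map-proj₁-select : ∀ xs → map proj₁ (select xs) ≡ xs
  map-proj₁-select []       = refl
  map-proj₁-select (x ∷ xs) =
    cong (x ∷_) (trans (sym (map-∘ (select xs))) (map-proj₁-select xs))

  length-select : ∀ xs → length (select xs) ≡ length xs
  length-select xs = trans (sym (length-map proj₁ (select xs))) (cong length (map-proj₁-select xs))

  Unique-↭-tail : ∀ {xs x r} → Unique xs → xs ↭ x ∷ r → Unique r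
  Unique-↭-tail u p with Permutationₛ.Unique-resp-↭ (setoid A) (↭⇒↭ₛ p) u
  ... | _ ∷ u′ = u′

  length-↭-tail : ∀ {xs : List A} {x r n} → length xs ≡ suc n → xs ↭ x ∷ r → length r ≡ n
  length-↭-tail eq p = suc-injective (trans (sym (↭-length p)) eq)

module _ {a b} {A : Set a} {B : Set b} where

  length-concatMap : ∀ (f : A → List B) {c} xs →
    (∀ {x} → x ∈ xs → length (f x) ≡ c) → length (concatMap f xs) ≡ length xs * c
  length-concatMap f []       _ = refl
  length-concatMap f (x ∷ xs) h =
    trans (length-++ (f x)) (cong₂ _+_ (h (here refl)) (length-concatMap f xs (λ p → h (there p))))

  Unique-concatMap : ∀ {c} {C : Set c} (f : A → List B) (g : A → C) {xs} →
    Unique (map g xs) → (∀ {x} → x ∈ xs → Unique (f x)) →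
    (∀ {x x′ y} → y ∈ f x → y ∈ f x′ → g x ≡ g x′) → Unique (concatMap f xs)
  Unique-concatMap f g {[]}     _          _  _      = []
  Unique-concatMap f g {x ∷ xs} (gx∉ ∷ u) uf shared =
    Unique.++⁺ (uf (here refl)) (Unique-concatMap f g u (λ p → uf (there p)) shared) disjoint
    where
    disjoint : ∀ {y} → y ∈ f x × y ∈ concatMap f xs → ⊥
    disjoint (y∈fx , y∈rest) =
      let x′ , x′∈xs , y∈fx′ = find (∈-concatMap⁻ f {xs = xs} y∈rest)
      in All.lookup (All.map⁻ gx∉) x′∈xs (shared y∈fx y∈fx′)

module _ {a b} {A : Set a} {B : Set b} where

  pickEach : (A → List A → List B) → List A → List B
  pickEach f xs = concatMap (uncurry f) (select xs)

  ∈-pickEach⁻ : ∀ f xs {y} → y ∈ pickEach f xs → ∃₂ λ x r → xs ↭ x ∷ r × y ∈ f x r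
  ∈-pickEach⁻ f xs y∈ with find (∈-concatMap⁻ (uncurry f) {xs = select xs} y∈)
  ... | (x , r) , q , y∈fxr = x , r , select-↭ q , y∈fxr

  ∈-pickEach⁺ : ∀ f {xs x y} → x ∈ xs → (∀ {r} → xs ↭ x ∷ r → y ∈ f x r) → y ∈ pickEach f xs
  ∈-pickEach⁺ f x∈xs h =
    let r , q = ∈-select x∈xs in ∈-concatMap⁺ (uncurry f) (lose q (h (select-↭ q)))

  length-pickEach : ∀ f xs {c} → (∀ {x r} → xs ↭ x ∷ r → length (f x r) ≡ c) →
    length (pickEach f xs) ≡ length xs * c
  length-pickEach f xs {c} h =
    trans (length-concatMap (uncurry f) (select xs) (λ q → h (select-↭ q)))
          (cong (_* c) (length-select xs))

  Unique-pickEach : ∀ f {xs} → Unique xs →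
    (∀ {x r} → xs ↭ x ∷ r → Unique (f x r)) →
    (∀ {x x′ r r′ y} → y ∈ f x r → y ∈ f x′ r′ → x ≡ x′) → Unique (pickEach f xs)
  Unique-pickEach f {xs} u uf shared =
    Unique-concatMap (uncurry f) proj₁ (subst Unique (sym (map-proj₁-select xs)) u)
      (λ q → uf (select-↭ q)) shared

mutual
  forestCount : ℕ → ℕ → ℕ → ℕ → ℕ
  forestCount d zero    zero    zero    = 1
  forestCount d zero    zero    (suc _) = 0
  forestCount d zero    (suc _) _       = 0
  forestCount d (suc k) s       t       = t * forestCount d k s (pred t) + nodeFirstCount d k s t

  nodeFirstCount : ℕ → ℕ → ℕ → ℕ → ℕ
  nodeFirstCount d k zero    t = 0
  nodeFirstCount d k (suc s) t = suc s * forestCount d (d + k) s t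

forestCount-leaves : ∀ d k → forestCount d k 0 k ≡ k !
forestCount-leaves d zero    = refl
forestCount-leaves d (suc k) = trans (+-identityʳ _) (cong (suc k *_) (forestCount-leaves d k))

forestCount-closed-step : ∀ e k s → let N = suc e * s + (e + k) in
  forestCount (suc e) k (suc s) (e * suc s + k) ≡ k * N ! →
  forestCount (suc e) (suc (e + k)) s (e * s + suc (e + k)) ≡ suc (e + k) * N ! →
  forestCount (suc e) (suc k) (suc s) (e * suc s + suc k) ≡ suc k * (suc e * suc s + k) !
forestCount-closed-step e k s leafPart nodePart = begin
  forestCount (suc e) (suc k) (suc s) (e * suc s + suc k)
    ≡⟨ cong (forestCount (suc e) (suc k) (suc s)) (+-suc (e * suc s) k) ⟩
  suc (e * suc s + k) * forestCount (suc e) k (suc s) (e * suc s + k)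
    + suc s * forestCount (suc e) (suc e + k) s (suc (e * suc s + k))
    ≡⟨ cong₂ (λ a b → suc (e * suc s + k) * a + suc s * b) leafPart
             (trans (cong (forestCount (suc e) (suc e + k) s) (shift e s k)) nodePart) ⟩
  suc (e * suc s + k) * (k * N !) + suc s * (suc (e + k) * N !)
    ≡⟨ recurrence e s k (N !) ⟩
  suc k * (suc N * N !)
    ≡⟨ cong (λ m → suc k * m !) (sym (size e s k)) ⟩
  suc k * (suc e * suc s + k) ! ∎
  where
  open ≡-Reasoning
  N = suc e * s + (e + k)

  shift : ∀ e s k → suc (e * suc s + k) ≡ e * s + suc (e + k)
  shift = solve-∀

  recurrence : ∀ e s k X → suc (e * suc s + k) * (k * X) + suc s * (suc (e + k) * X)
                         ≡ suc k * (suc (suc e * s + (e + k)) * X)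
  recurrence = solve-∀

  size : ∀ e s k → suc e * suc s + k ≡ suc (suc e * s + (e + k))
  size = solve-∀

-- Stated for d = suc e and suc k trees, so that t = (d-1)s + k and (ds+k-1)!
-- need no truncated subtraction.
forestCount-closed : ∀ e k s →
  forestCount (suc e) (suc k) s (e * s + suc k) ≡ suc k * (suc e * s + k) !
forestCount-closed e k zero = begin
  forestCount (suc e) (suc k) 0 (e * 0 + suc k)
    ≡⟨ cong (λ m → forestCount (suc e) (suc k) 0 (m + suc k)) (*-zeroʳ e) ⟩
  forestCount (suc e) (suc k) 0 (suc k)
    ≡⟨ forestCount-leaves (suc e) (suc k) ⟩
  suc k * k !
    ≡⟨ cong (λ m → suc k * (m + k) !) (sym (*-zeroʳ (suc e))) ⟩
  suc k * (suc e * 0 + k) ! ∎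
  where open ≡-Reasoning
forestCount-closed e zero (suc s) =
  forestCount-closed-step e zero s refl (forestCount-closed e (e + zero) s)
forestCount-closed e (suc k) (suc s) =
  forestCount-closed-step e (suc k) s
    (trans (forestCount-closed e k (suc s)) (cong (λ m → suc k * m !) (regroup e s k)))
    (forestCount-closed e (e + suc k) s)
  where
  regroup : ∀ e s k → suc e * suc s + k ≡ suc e * s + (e + suc k)
  regroup = solve-∀

module Forests (d : ℕ) where

  Forest : ℕ → Set
  Forest = Vec (Tree d)

  LabeledBy : ∀ {k} → List ℕ → List ℕ → Forest k → Set
  LabeledBy S T v = (nodeLabelsV v ↭ S) × (leafLabelsV v ↭ T)

  nodeLabelsV-++ : ∀ {m n} (u : Forest m) (v : Forest n) →
    nodeLabelsV (u ++ᵥ v) ≡ nodeLabelsV u ++ nodeLabelsV v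
  nodeLabelsV-++ []      v = refl
  nodeLabelsV-++ (t ∷ u) v =
    trans (cong (nodeLabels t ++_) (nodeLabelsV-++ u v)) (sym (++-assoc (nodeLabels t) _ _))

  leafLabelsV-++ : ∀ {m n} (u : Forest m) (v : Forest n) →
    leafLabelsV (u ++ᵥ v) ≡ leafLabelsV u ++ leafLabelsV v
  leafLabelsV-++ []      v = refl
  leafLabelsV-++ (t ∷ u) v =
    trans (cong (leafLabels t ++_) (leafLabelsV-++ u v)) (sym (++-assoc (leafLabels t) _ _))

  graft : ∀ {k} → ℕ → Forest (d + k) → Forest (suc k)
  graft x v = node x (take d v) ∷ drop d v

  nodeLabelsV-graft : ∀ {k} x (v : Forest (d + k)) → nodeLabelsV (graft x v) ≡ x ∷ nodeLabelsV v
  nodeLabelsV-graft x v = cong (x ∷_) (trans (sym (nodeLabelsV-++ (take d v) (drop d v)))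
                                              (cong nodeLabelsV (take++drop≡id d v)))

  leafLabelsV-graft : ∀ {k} x (v : Forest (d + k)) → leafLabelsV (graft x v) ≡ leafLabelsV v
  leafLabelsV-graft x v =
    trans (sym (leafLabelsV-++ (take d v) (drop d v))) (cong leafLabelsV (take++drop≡id d v))

  node-injectiveʳ : ∀ {x y} {ts us : Forest d} → node x ts ≡ node y us → ts ≡ us
  node-injectiveʳ refl = refl

  graft-injective : ∀ {k x} {v w : Forest (d + k)} → graft x v ≡ graft x w → v ≡ w
  graft-injective {v = v} {w} eq = begin
    v                     ≡⟨ sym (take++drop≡id d v) ⟩
    take d v ++ᵥ drop d v ≡⟨ cong₂ _++ᵥ_ (node-injectiveʳ (∷-injectiveˡ eq)) (∷-injectiveʳ eq) ⟩
    take d w ++ᵥ drop d w ≡⟨ take++drop≡id d w ⟩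
    w                     ∎
    where open ≡-Reasoning

  graft-++ : ∀ {k} x (ts : Forest d) (v : Forest k) → graft x (ts ++ᵥ v) ≡ node x ts ∷ v
  graft-++ x ts v =
    cong₂ (λ us w → node x us ∷ w) (++-injectiveˡ _ ts split) (++-injectiveʳ _ ts split)
    where split = take++drop≡id d (ts ++ᵥ v)

  -- The index s always equals length S; it makes the recursion structural
  -- (lexicographic in s, then k).
  mutual
    forests : ∀ k → ℕ → List ℕ → List ℕ → List (Forest k)
    forests zero    _ []      []      = [ [] ]
    forests zero    _ []      (_ ∷ _) = []
    forests zero    _ (_ ∷ _) _       = []
    forests (suc k) s S       T       = leafFirst k s S T ++ nodeFirst k s S T

    leafFirst : ∀ k → ℕ → List ℕ → List ℕ → List (Forest (suc k))
    leafFirst k s S = pickEach (λ x T′ → map (leaf x ∷_) (forests k s S T′))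

    nodeFirst : ∀ k → ℕ → List ℕ → List ℕ → List (Forest (suc k))
    nodeFirst k zero    S T = []
    nodeFirst k (suc s) S T = pickEach (λ x S′ → map (graft x) (forests (d + k) s S′ T)) S

  mutual
    forests-sound : ∀ k s S T {v} → v ∈ forests k s S T → LabeledBy S T v
    forests-sound zero    _ []  []  (here refl) = ↭-refl , ↭-refl
    forests-sound (suc k) s S T v∈ with ∈-++⁻ (leafFirst k s S T) v∈
    ... | inj₁ v∈leafFirst = leafFirst-sound k s S T v∈leafFirst
    ... | inj₂ v∈nodeFirst = nodeFirst-sound k s S T v∈nodeFirst

    leafFirst-sound : ∀ k s S T {v} → v ∈ leafFirst k s S T → LabeledBy S T v
    leafFirst-sound k s S T v∈ with ∈-pickEach⁻ _ T v∈
    ... | x , T′ , T↭ , w∈ with ∈-map⁻ (leaf x ∷_) w∈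
    ... | w , w∈forests , refl =
      let nodes , leaves = forests-sound k s S T′ w∈forests
      in nodes , ↭-trans (↭-prep x leaves) (↭-sym T↭)

    nodeFirst-sound : ∀ k s S T {v} → v ∈ nodeFirst k s S T → LabeledBy S T v
    nodeFirst-sound k (suc s) S T v∈ with ∈-pickEach⁻ _ S v∈
    ... | x , S′ , S↭ , w∈ with ∈-map⁻ (graft x) w∈
    ... | w , w∈forests , refl =
      let nodes , leaves = forests-sound (d + k) s S′ T w∈forests
      in subst (_↭ S) (sym (nodeLabelsV-graft x w)) (↭-trans (↭-prep x nodes) (↭-sym S↭)) ,
         subst (_↭ T) (sym (leafLabelsV-graft x w)) leaves

  mutual
    forests-complete : ∀ k s S T (v : Forest k) → length S ≡ s →
      LabeledBy S T v → v ∈ forests k s S T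
    forests-complete zero    _ []      []      [] _ _ = here refl
    forests-complete zero    _ []      (_ ∷ _) [] _ (_ , leaves) with ↭-length leaves
    ... | ()
    forests-complete zero    _ (_ ∷ _) _       [] _ (nodes , _) with ↭-length nodes
    ... | ()
    forests-complete (suc k) s S T (leaf x ∷ v) eq (nodes , leaves) =
      ∈-++⁺ˡ (∈-pickEach⁺ _ (∈-resp-↭ leaves (here refl)) λ T↭ →
        ∈-map⁺ (leaf x ∷_) (forests-complete k s S _ v eq (nodes , drop-∷ (↭-trans leaves T↭))))
    forests-complete (suc k) s S T (node x ts ∷ v) eq labeled =
      ∈-++⁺ʳ (leafFirst k s S T)
        (subst (_∈ nodeFirst k s S T) (graft-++ x ts v)
          (nodeFirst-complete k s S T x (ts ++ᵥ v) eq
            (subst (LabeledBy S T) (sym (graft-++ x ts v)) labeled)))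

    nodeFirst-complete : ∀ k s S T x (w : Forest (d + k)) → length S ≡ s →
      LabeledBy S T (graft x w) → graft x w ∈ nodeFirst k s S T
    nodeFirst-complete k zero [] T x w _ (nodes , _)
      with ∈-resp-↭ (subst (_↭ []) (nodeLabelsV-graft x w) nodes) (here refl)
    ... | ()
    nodeFirst-complete k (suc s) S T x w eq (nodes , leaves) =
      ∈-pickEach⁺ _ (∈-resp-↭ nodes′ (here refl)) λ S↭ →
        ∈-map⁺ (graft x) (forests-complete (d + k) s _ T w (length-↭-tail eq S↭)
          (drop-∷ (↭-trans nodes′ S↭) , subst (_↭ T) (leafLabelsV-graft x w) leaves))
      where nodes′ = subst (_↭ S) (nodeLabelsV-graft x w) nodes

  root : Tree d → ℕ ⊎ ℕ
  root (leaf x)   = inj₁ x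
  root (node x _) = inj₂ x

  root-∈-map-leaf∷ : ∀ {k x} {ws : List (Forest k)} {v} →
    v ∈ map (leaf x ∷_) ws → root (head v) ≡ inj₁ x
  root-∈-map-leaf∷ v∈ with ∈-map⁻ _ v∈
  ... | _ , _ , refl = refl

  root-∈-map-graft : ∀ {k x} {ws : List (Forest (d + k))} {v} →
    v ∈ map (graft x) ws → root (head v) ≡ inj₂ x
  root-∈-map-graft v∈ with ∈-map⁻ _ v∈
  ... | _ , _ , refl = refl

  leafFirst-root : ∀ k s S T {v} → v ∈ leafFirst k s S T → ∃ λ x → root (head v) ≡ inj₁ x
  leafFirst-root k s S T v∈ with ∈-pickEach⁻ _ T v∈
  ... | x , _ , _ , w∈ = x , root-∈-map-leaf∷ w∈

  nodeFirst-root : ∀ k s S T {v} → v ∈ nodeFirst k s S T → ∃ λ x → root (head v) ≡ inj₂ x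
  nodeFirst-root k (suc s) S T v∈ with ∈-pickEach⁻ _ S v∈
  ... | x , _ , _ , w∈ = x , root-∈-map-graft w∈

  mutual
    forests-unique : ∀ k s {S T} → Unique S → Unique T → Unique (forests k s S T)
    forests-unique zero    _ {[]}    {[]}    _  _  = [] ∷ []
    forests-unique zero    _ {[]}    {_ ∷ _} _  _  = []
    forests-unique zero    _ {_ ∷ _}         _  _  = []
    forests-unique (suc k) s {S}     {T}     uS uT =
      Unique.++⁺ (leafFirst-unique k s uS uT) (nodeFirst-unique k s uS uT) leaf≢node
      where
      leaf≢node : ∀ {v} → v ∈ leafFirst k s S T × v ∈ nodeFirst k s S T → ⊥
      leaf≢node (p , q) with leafFirst-root k s S T p | nodeFirst-root k s S T q
      ... | _ , isLeaf | _ , isNode with trans (sym isLeaf) isNode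
      ... | ()

    leafFirst-unique : ∀ k s {S T} → Unique S → Unique T → Unique (leafFirst k s S T)
    leafFirst-unique k s uS uT =
      Unique-pickEach _ uT
        (λ T↭ → Unique.map⁺ ∷-injectiveʳ (forests-unique k s uS (Unique-↭-tail uT T↭)))
        (λ p q → inj₁-injective (trans (sym (root-∈-map-leaf∷ p)) (root-∈-map-leaf∷ q)))

    nodeFirst-unique : ∀ k s {S T} → Unique S → Unique T → Unique (nodeFirst k s S T)
    nodeFirst-unique k zero    _  _  = []
    nodeFirst-unique k (suc s) uS uT =
      Unique-pickEach _ uS
        (λ S↭ → Unique.map⁺ graft-injective (forests-unique (d + k) s (Unique-↭-tail uS S↭) uT))
        (λ p q → inj₂-injective (trans (sym (root-∈-map-graft p)) (root-∈-map-graft q)))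

  mutual
    length-forests : ∀ k s S T → length S ≡ s →
      length (forests k s S T) ≡ forestCount d k s (length T)
    length-forests zero    _ []      []      refl = refl
    length-forests zero    _ []      (_ ∷ _) refl = refl
    length-forests zero    _ (_ ∷ _) _       refl = refl
    length-forests (suc k) s S       T       eq   =
      trans (length-++ (leafFirst k s S T))
            (cong₂ _+_ (length-leafFirst k s S T eq) (length-nodeFirst k s S T eq))

    length-leafFirst : ∀ k s S T → length S ≡ s →
      length (leafFirst k s S T) ≡ length T * forestCount d k s (pred (length T))
    length-leafFirst k s S T eq = length-pickEach _ T λ {x} {T′} T↭ →
      trans (length-map (leaf x ∷_) (forests k s S T′))
            (trans (length-forests k s S T′ eq)
                   (cong (forestCount d k s) (sym (cong pred (↭-length T↭)))))

    length-nodeFirst : ∀ k s S T → length S ≡ s →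
      length (nodeFirst k s S T) ≡ nodeFirstCount d k s (length T)
    length-nodeFirst k zero    S T _  = refl
    length-nodeFirst k (suc s) S T eq =
      trans (length-pickEach _ S λ {x} {S′} S↭ →
               trans (length-map (graft x) (forests (d + k) s S′ T))
                     (length-forests (d + k) s S′ T (length-↭-tail eq S↭)))
            (cong (_* forestCount d (d + k) s (length T)) eq)

  trees : ℕ → List ℕ → List ℕ → List (Tree d)
  trees s S T = map head (forests 1 s S T)

  trees-sound : ∀ s S T {t} → t ∈ trees s S T → (nodeLabels t ↭ S) × (leafLabels t ↭ T)
  trees-sound s S T t∈ with ∈-map⁻ head {xs = forests 1 s S T} t∈
  ... | t ∷ [] , v∈ , refl =
    let nodes , leaves = forests-sound 1 s S T v∈
    in subst (_↭ S) (++-identityʳ _) nodes , subst (_↭ T) (++-identityʳ _) leaves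

  trees-complete : ∀ s S T {t} → length S ≡ s →
    nodeLabels t ↭ S → leafLabels t ↭ T → t ∈ trees s S T
  trees-complete s S T {t} eq nodes leaves =
    ∈-map⁺ head (forests-complete 1 s S T (t ∷ []) eq
      (subst (_↭ S) (sym (++-identityʳ _)) nodes , subst (_↭ T) (sym (++-identityʳ _)) leaves))

  trees-unique : ∀ s {S T} → Unique S → Unique T → Unique (trees s S T)
  trees-unique s uS uT = Unique.map⁺ head-injective (forests-unique 1 s uS uT)
    where
    head-injective : ∀ {v w : Forest 1} → head v ≡ head w → v ≡ w
    head-injective {_ ∷ []} {_ ∷ []} refl = refl

  length-trees : ∀ s S T → length S ≡ s → length (trees s S T) ≡ forestCount d 1 s (length T)
  length-trees s S T eq = trans (length-map head (forests 1 s S T)) (length-forests 1 s S T eq)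

mainTheorem1 : ∀ (d n : ℕ) → 1 ≤ d → 1 ≤ n →
    ∃ λ (L : List (Tree d)) →
    Unique L × All (Labeled d n) L × (∀ t → Labeled d n t → t ∈ L) ×
    length L ≡ (d * n) !
mainTheorem1 zero    _ () _
mainTheorem1 (suc e) n _  _ =
  trees n S T ,
  trees-unique n (Unique.upTo⁺ n) (Unique.map⁺ (+-cancelˡ-≡ n _ _) (Unique.upTo⁺ _)) ,
  All.tabulate (trees-sound n S T) ,
  (λ _ (nodes , leaves) → trees-complete n S T (length-upTo n) nodes leaves) ,
  count
  where
  open Forests (suc e)
  open ≡-Reasoning
  S = upTo n
  T = map (n +_) (upTo (e * n + 1))

  count : length (trees n S T) ≡ (suc e * n) !
  count = begin
    length (trees n S T)                ≡⟨ length-trees n S T (length-upTo n) ⟩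
    forestCount (suc e) 1 n (length T)  ≡⟨ cong (forestCount (suc e) 1 n) length-T ⟩
    forestCount (suc e) 1 n (e * n + 1) ≡⟨ forestCount-closed e 0 n ⟩
    1 * (suc e * n + 0) !               ≡⟨ *-identityˡ _ ⟩
    (suc e * n + 0) !                   ≡⟨ cong _! (+-identityʳ (suc e * n)) ⟩
    (suc e * n) !                       ∎
    where
    length-T : length T ≡ e * n + 1
    length-T = trans (length-map (n +_) (upTo (e * n + 1))) (length-upTo (e * n + 1))
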